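{- Let $\mathcal{P}$ be a polynomial system over a finite domain $D\subseteq\mathbb{Q}$. Then $\mathcal{P}$ is explicitly Archimedean.
   Context: A polynomial system over a finite domain $D=\{\rho_1,\dots,\rho_{2k}\}$ of rational values (repetitions allowed, $k$ constant) is a system of polynomial equations in $x_1,\dots,x_n$ containing $D_{2k}(x_j)=(x_j-\rho_1)\cdots(x_j-\rho_{2k})=0$ for every $j\in[n]$. An SoS proof of "$q\ge0$" from $\mathcal{P}=\{p_i=0\}$ is an identity $q=\sum s_i^2+\sum h_ip_i$, of degree $\max(\deg s_i^2,\deg h_ip_i)$. With $d$ fixed and bounds as $n\to\infty$, $\mathcal{P}$ is explicitly Archimedean if for every $i\in[n]$ there is $0<N\le 2^{\mathrm{poly}(n^d)}$ such that there exist SoS proofs of "$N-x_i\ge0$" and "$N+x_i\ge0$" from $\mathcal{P}$ of degree $O(d)$ with coefficients bounded in absolute value by $2^{\mathrm{poly}(n^d)}$. -}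

module Defs where

open import Data.Nat as ℕ using (ℕ; _^_)
open import Data.Integer using (+_)
open import Data.Rational as ℚ using (ℚ; 0ℚ; 1ℚ)
open import Data.Product using (_×_; _,_; Σ; ∃)
open import Data.List as List using (List; []; _∷_; _++_; length)
open import Data.List.Relation.Unary.Any using (Any)
open import Data.List.Relation.Unary.All using (All)
open import Data.Unit using (⊤)
open import Data.Vec as Vec using (Vec; []; _∷_)
open import Data.Vec.Properties using (≡-dec)
open import Data.Fin using (Fin)
open import Relation.Nullary using (yes; no; ¬_)
open import Relation.Binary.PropositionalEquality using (_≡_)

-- Multivariate polynomials over ℚ in the variables x₁,…,xₙ
-- A monomial is its exponent vector; a polynomial is a finite (formal)
-- list of terms c·x^e.  Two representations denote the same polynomial
-- iff all their (collected) coefficients agree (_≈P_).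

Mono : ℕ → Set
Mono n = Vec ℕ n

Poly : ℕ → Set
Poly n = List (ℚ × Mono n)

coeff : ∀ {n} → Poly n → Mono n → ℚ
coeff [] m = 0ℚ
coeff ((c , e) ∷ p) m with ≡-dec ℕ._≟_ e m
... | yes _ = c ℚ.+ coeff p m
... | no  _ = coeff p m

_≈P_ : ∀ {n} → Poly n → Poly n → Set
p ≈P q = ∀ m → coeff p m ≡ coeff q m

infixl 6 _⊕_
infixl 7 _⊗_

_⊕_ : ∀ {n} → Poly n → Poly n → Poly n
p ⊕ q = p ++ q

_⊗_ : ∀ {n} → Poly n → Poly n → Poly n
p ⊗ q = List.concatMap
          (λ { (c , e) → List.map (λ { (c′ , e′) → (c ℚ.* c′ , Vec.zipWith ℕ._+_ e e′) }) q })
          p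

zeroP : ∀ {n} → Poly n
zeroP = []

constP : ∀ {n} → ℚ → Poly n
constP {n} c = (c , Vec.replicate n 0) ∷ []

negP : ∀ {n} → Poly n → Poly n
negP p = List.map (λ { (c , e) → (ℚ.- c , e) }) p

varP : ∀ {n} → Fin n → Poly n
varP {n} i = (1ℚ , Vec.updateAt (Vec.replicate n 0) i (λ _ → 1)) ∷ []

sumP : ∀ {n} → List (Poly n) → Poly n
sumP = List.foldr _⊕_ zeroP

mdeg : ∀ {n} → Mono n → ℕ
mdeg = Vec.sum

DegLE : ∀ {n} → Poly n → ℕ → Set
DegLE p t = ∀ m → ¬ (coeff p m ≡ 0ℚ) → mdeg m ℕ.≤ t

CoeffLE : ∀ {n} → Poly n → ℚ → Set
CoeffLE p B = ∀ m → ℚ.∣ coeff p m ∣ ℚ.≤ B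

ℕ→ℚ : ℕ → ℚ
ℕ→ℚ k = + k ℚ./ 1

domainPoly : ∀ {n m} → Vec ℚ m → Fin n → Poly n
domainPoly ρ j = Vec.foldr _ (λ r acc → (varP j ⊕ constP (ℚ.- r)) ⊗ acc) (constP 1ℚ) ρ

-- 𝒫 (a finite list of polynomials, read as equations p = 0) contains
-- D_{2k}(x_j) for every variable j
IsSystemOver : ∀ {n m} → Vec ℚ m → List (Poly n) → Set
IsSystemOver {n} ρ 𝒫 = ∀ (j : Fin n) → Any (λ p → p ≈P domainPoly ρ j) 𝒫

combo : ∀ {n} (𝒫 : List (Poly n)) → Vec (Poly n) (length 𝒫) → Poly n
combo [] [] = zeroP
combo (p ∷ 𝒫) (h ∷ hs) = h ⊗ p ⊕ combo 𝒫 hs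

AllPairs : ∀ {n} (R : Poly n → Poly n → Set) (𝒫 : List (Poly n)) → Vec (Poly n) (length 𝒫) → Set
AllPairs R [] [] = ⊤
AllPairs R (p ∷ 𝒫) (h ∷ hs) = R p h × AllPairs R 𝒫 hs

record SoSProof {n} (𝒫 : List (Poly n)) (q : Poly n) (t : ℕ) (B : ℚ) : Set where
  field
    squares     : List (Poly n)
    multipliers : Vec (Poly n) (length 𝒫)
    identity    : q ≈P (sumP (List.map (λ s → s ⊗ s) squares) ⊕ combo 𝒫 multipliers)
    degSquares  : All (λ s → DegLE (s ⊗ s) t) squares
    degMults    : AllPairs (λ p h → DegLE (h ⊗ p) t) 𝒫 multipliers
    coeffSquares : All (λ s → CoeffLE s B) squares
    coeffMults  : AllPairs (λ p h → CoeffLE h B) 𝒫 multipliers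

{-# OPTIONS --safe #-}
module Submission where

-- Write D(x) = (x - r₁)⋯(x - r_m) for the domain polynomial of a single variable x = xᵢ.
-- By induction on the roots there is a constant M ≥ 0 with
--   M - x² = Σ s² + h·D(x),   deg s ≤ m + 1,  deg h ≤ m + 2,
-- where all s and h involve only x: to add a root r, multiply the certificate for the other
-- roots by (x - r)² and absorb the difference with one polynomial identity.  Then N = M + ½
-- satisfies N ∓ x = (M - x²) + (x ∓ ½)² + (½)², an SoS proof of degree 2(m + 1) that uses
-- only the equation D(x) = 0.  Its coefficient list does not depend on the number of
-- variables or on i, so all its coefficients are bounded by a constant depending on the
-- roots alone, which lies below 2^a for a suitable a.

open import Defs
open import Data.Nat using (ℕ; _+_; _*_; _^_)
open import Data.Rational using (ℚ; _<_; _≤_; 0ℚ; -_)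
open import Data.Vec using (Vec)
open import Data.List using (List)
open import Data.Fin using (Fin)
open import Data.Product using (Σ; ∃; _×_)

open import Algebra.Bundles using (CommutativeRing)
import Algebra.Properties.CommutativeSemigroup as CommutativeSemigroupProperties
open import Data.Empty using (⊥-elim)
import Data.Fin as Fin
open import Data.Integer using (+_)
import Data.Integer as ℤ
import Data.Integer.Properties as ℤ
open import Data.List using ([]; _∷_; _++_; length)
import Data.List as List
import Data.List.Properties as List
open import Data.List.Relation.Binary.Pointwise as Pointwise using (Pointwise; []; _∷_)
open import Data.List.Relation.Unary.All as All using (All; []; _∷_)
import Data.List.Relation.Unary.All.Properties as All
open import Data.List.Relation.Unary.Any using (Any; here; there)
open import Data.Maybe using (just; nothing)
open import Data.Nat using (zero; suc)
import Data.Nat as ℕ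
import Data.Nat.Coprimality as Coprime
import Data.Nat.Properties as ℕ
open import Data.Product using (_,_; proj₁; proj₂)
open import Data.Rational using (1ℚ; _⊔_)
import Data.Rational as ℚ
import Data.Rational.Properties as ℚ
open import Data.Rational.Solver using () renaming (module +-*-Solver to ℚ-Solver)
open import Data.Sum using (inj₁; inj₂)
open import Data.Unit using (tt)
open import Data.Vec using ([]; _∷_)
import Data.Vec as Vec
import Data.Vec.Properties as Vec
open import Data.Vec.Properties using (≡-dec)
open import Level using (0ℓ)
open import Relation.Binary.Definitions using (WeaklyDecidable)
open import Relation.Binary.PropositionalEquality
  using (_≡_; refl; sym; trans; cong; cong₂; subst; subst₂; module ≡-Reasoning)
open import Relation.Binary.Structures using (IsEquivalence)
open import Relation.Nullary using (yes; no; ¬_)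

private
  variable
    A A′ : Set

open CommutativeSemigroupProperties (CommutativeRing.+-commutativeSemigroup ℚ.+-*-commutativeRing)
  using (interchange)

p≤p+q : ∀ {p q} → 0ℚ ≤ q → p ≤ p ℚ.+ q
p≤p+q {p} q≥0 = ℚ.≤-trans (ℚ.≤-reflexive (sym (ℚ.+-identityʳ p))) (ℚ.+-monoʳ-≤ p q≥0)

p≤q+p : ∀ {p q} → 0ℚ ≤ q → p ≤ q ℚ.+ p
p≤q+p {p} q≥0 = ℚ.≤-trans (ℚ.≤-reflexive (sym (ℚ.+-identityˡ p))) (ℚ.+-monoˡ-≤ p q≥0)

sumBy : (A → ℚ) → List A → ℚ
sumBy f []       = 0ℚ
sumBy f (a ∷ as) = f a ℚ.+ sumBy f as

sumBy-++ : ∀ (f : A → ℚ) as bs → sumBy f (as ++ bs) ≡ sumBy f as ℚ.+ sumBy f bs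
sumBy-++ f []       bs = sym (ℚ.+-identityˡ _)
sumBy-++ f (a ∷ as) bs = trans (cong (f a ℚ.+_) (sumBy-++ f as bs)) (sym (ℚ.+-assoc (f a) _ _))

sumBy-cong : ∀ {f g : A → ℚ} → (∀ a → f a ≡ g a) → ∀ as → sumBy f as ≡ sumBy g as
sumBy-cong f≗g []       = refl
sumBy-cong f≗g (a ∷ as) = cong₂ ℚ._+_ (f≗g a) (sumBy-cong f≗g as)

sumBy-map : ∀ (f : A′ → ℚ) (g : A → A′) as → sumBy f (List.map g as) ≡ sumBy (λ a → f (g a)) as
sumBy-map f g []       = refl
sumBy-map f g (a ∷ as) = cong (f (g a) ℚ.+_) (sumBy-map f g as)

sumBy-zero : ∀ (as : List A) → sumBy (λ _ → 0ℚ) as ≡ 0ℚ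
sumBy-zero []       = refl
sumBy-zero (a ∷ as) = trans (ℚ.+-identityˡ _) (sumBy-zero as)

sumBy-+ : ∀ (f g : A → ℚ) as → sumBy (λ a → f a ℚ.+ g a) as ≡ sumBy f as ℚ.+ sumBy g as
sumBy-+ f g []       = refl
sumBy-+ f g (a ∷ as) =
  trans (cong ((f a ℚ.+ g a) ℚ.+_) (sumBy-+ f g as)) (interchange (f a) (g a) (sumBy f as) (sumBy g as))

sumBy-*ˡ : ∀ c (f : A → ℚ) as → sumBy (λ a → c ℚ.* f a) as ≡ c ℚ.* sumBy f as
sumBy-*ˡ c f []       = sym (ℚ.*-zeroʳ c)
sumBy-*ˡ c f (a ∷ as) =
  trans (cong (c ℚ.* f a ℚ.+_) (sumBy-*ˡ c f as)) (sym (ℚ.*-distribˡ-+ c (f a) (sumBy f as)))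

sumBy-swap : ∀ (f : A → A′ → ℚ) as bs →
             sumBy (λ a → sumBy (f a) bs) as ≡ sumBy (λ b → sumBy (λ a → f a b) as) bs
sumBy-swap f []       bs = sym (sumBy-zero bs)
sumBy-swap f (a ∷ as) bs = trans (cong (sumBy (f a) bs ℚ.+_) (sumBy-swap f as bs))
                                 (sym (sumBy-+ (f a) (λ b → sumBy (λ a → f a b) as) bs))

sumBy-nonNeg : ∀ (f : A → ℚ) → (∀ a → 0ℚ ≤ f a) → ∀ as → 0ℚ ≤ sumBy f as
sumBy-nonNeg f f≥0 []       = ℚ.≤-refl
sumBy-nonNeg f f≥0 (a ∷ as) = ℚ.+-mono-≤ (f≥0 a) (sumBy-nonNeg f f≥0 as)

-- Polynomials form a commutative ring up to equality of coefficients

infixl 6 _+ₘ_ _∸ₘ_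
infix  4 _∣ₘ_ _≋_

_+ₘ_ : ∀ {n} → Mono n → Mono n → Mono n
_+ₘ_ = Vec.zipWith ℕ._+_

_∸ₘ_ : ∀ {n} → Mono n → Mono n → Mono n
_∸ₘ_ = Vec.zipWith ℕ._∸_

+ₘ-∸ₘ-cancelˡ : ∀ {n} (e e′ : Mono n) → e +ₘ e′ ∸ₘ e ≡ e′
+ₘ-∸ₘ-cancelˡ []      []        = refl
+ₘ-∸ₘ-cancelˡ (a ∷ e) (b ∷ e′) = cong₂ _∷_ (ℕ.m+n∸m≡n a b) (+ₘ-∸ₘ-cancelˡ e e′)

_∣ₘ_ : ∀ {n} → Mono n → Mono n → Set
e ∣ₘ m = e +ₘ (m ∸ₘ e) ≡ m

-- _≈P_ unfolds to a Π-type from which Agda cannot recover the two polynomials; wrapping it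
-- in a record makes it usable as the equality of a ring and of setoid reasoning.
record _≋_ {n} (p q : Poly n) : Set where
  constructor coeffwise
  field coeff-≡ : p ≈P q
open _≋_ public

module _ {n : ℕ} where

  Term : Set
  Term = ℚ × Mono n

  termCoeff : Term → Mono n → ℚ
  termCoeff (c , e) m with ≡-dec ℕ._≟_ e m
  ... | yes _ = c
  ... | no  _ = 0ℚ

  _*ₜ_ : Term → Term → Term
  (c , e) *ₜ (c′ , e′) = (c ℚ.* c′ , e +ₘ e′)

  *ₜ-comm : ∀ t u → t *ₜ u ≡ u *ₜ t
  *ₜ-comm (c , e) (c′ , e′) = cong₂ _,_ (ℚ.*-comm c c′) (Vec.zipWith-comm ℕ.+-comm e e′)

  *ₜ-assoc : ∀ t u w → (t *ₜ u) *ₜ w ≡ t *ₜ (u *ₜ w)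
  *ₜ-assoc (c , e) (c′ , e′) (c″ , e″) =
    cong₂ _,_ (ℚ.*-assoc c c′ c″) (Vec.zipWith-assoc ℕ.+-assoc e e′ e″)

  coeff≡sumBy-termCoeff : ∀ (p : Poly n) m → coeff p m ≡ sumBy (λ t → termCoeff t m) p
  coeff≡sumBy-termCoeff []            m = refl
  coeff≡sumBy-termCoeff ((c , e) ∷ p) m with ≡-dec ℕ._≟_ e m
  ... | yes _ = cong (c ℚ.+_) (coeff≡sumBy-termCoeff p m)
  ... | no  _ = trans (coeff≡sumBy-termCoeff p m) (sym (ℚ.+-identityˡ _))

  coeff-⊕ : ∀ (p q : Poly n) m → coeff (p ⊕ q) m ≡ coeff p m ℚ.+ coeff q m
  coeff-⊕ []            q m = sym (ℚ.+-identityˡ _)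
  coeff-⊕ ((c , e) ∷ p) q m with ≡-dec ℕ._≟_ e m
  ... | yes _ = trans (cong (c ℚ.+_) (coeff-⊕ p q m)) (sym (ℚ.+-assoc c _ _))
  ... | no  _ = coeff-⊕ p q m

  coeff-negP : ∀ (p : Poly n) m → coeff (negP p) m ≡ ℚ.- coeff p m
  coeff-negP []            m = refl
  coeff-negP ((c , e) ∷ p) m with ≡-dec ℕ._≟_ e m
  ... | yes _ = trans (cong (ℚ.- c ℚ.+_) (coeff-negP p m)) (sym (ℚ.neg-distrib-+ c _))
  ... | no  _ = coeff-negP p m

  sumBy-⊗ : ∀ (f : Term → ℚ) (p q : Poly n) →
            sumBy f (p ⊗ q) ≡ sumBy (λ t → sumBy (λ u → f (t *ₜ u)) q) p
  sumBy-⊗ f []            q = refl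
  sumBy-⊗ f ((c , e) ∷ p) q =
    trans (sumBy-++ f (List.map _ q) (p ⊗ q)) (cong₂ ℚ._+_ (sumBy-map f _ q) (sumBy-⊗ f p q))

  rowCoeff : Term → Poly n → Mono n → ℚ
  rowCoeff t q m = sumBy (λ u → termCoeff (t *ₜ u) m) q

  coeff-⊗ : ∀ (p q : Poly n) m → coeff (p ⊗ q) m ≡ sumBy (λ t → rowCoeff t q m) p
  coeff-⊗ p q m = trans (coeff≡sumBy-termCoeff (p ⊗ q) m) (sumBy-⊗ (λ t → termCoeff t m) p q)

  termCoeff-*ₜ-∣ : ∀ c {e m} → e ∣ₘ m → ∀ u → termCoeff ((c , e) *ₜ u) m ≡ c ℚ.* termCoeff u (m ∸ₘ e)
  termCoeff-*ₜ-∣ c {e} {m} e∣m (c′ , e′)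
    with ≡-dec ℕ._≟_ (e +ₘ e′) m | ≡-dec ℕ._≟_ e′ (m ∸ₘ e)
  ... | yes _  | yes _  = refl
  ... | yes eq | no neq = ⊥-elim (neq (trans (sym (+ₘ-∸ₘ-cancelˡ e e′)) (cong (_∸ₘ e) eq)))
  ... | no neq | yes eq = ⊥-elim (neq (trans (cong (e +ₘ_) eq) e∣m))
  ... | no _   | no _   = sym (ℚ.*-zeroʳ c)

  termCoeff-*ₜ-∤ : ∀ c {e m} → ¬ e ∣ₘ m → ∀ u → termCoeff ((c , e) *ₜ u) m ≡ 0ℚ
  termCoeff-*ₜ-∤ c {e} {m} e∤m (c′ , e′) with ≡-dec ℕ._≟_ (e +ₘ e′) m
  ... | yes eq = ⊥-elim (e∤m (trans (cong (e +ₘ_) (trans (cong (_∸ₘ e) (sym eq)) (+ₘ-∸ₘ-cancelˡ e e′))) eq))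
  ... | no _   = refl

  rowCoeff-cong : ∀ t {q q′ : Poly n} → q ≋ q′ → ∀ m → rowCoeff t q m ≡ rowCoeff t q′ m
  rowCoeff-cong (c , e) {q} {q′} (coeffwise q≈q′) m with ≡-dec ℕ._≟_ (e +ₘ (m ∸ₘ e)) m
  ... | yes e∣m = begin
    rowCoeff (c , e) q m                   ≡⟨ sumBy-cong (termCoeff-*ₜ-∣ c e∣m) q ⟩
    sumBy (λ u → c ℚ.* termCoeff u m′) q   ≡⟨ sumBy-*ˡ c _ q ⟩
    c ℚ.* sumBy (λ u → termCoeff u m′) q   ≡⟨ cong (c ℚ.*_) same-coeff ⟩
    c ℚ.* sumBy (λ u → termCoeff u m′) q′  ≡⟨ sym (sumBy-*ˡ c _ q′) ⟩
    sumBy (λ u → c ℚ.* termCoeff u m′) q′  ≡⟨ sym (sumBy-cong (termCoeff-*ₜ-∣ c e∣m) q′) ⟩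
    rowCoeff (c , e) q′ m                  ∎
    where
    open ≡-Reasoning
    m′ = m ∸ₘ e
    same-coeff : sumBy (λ u → termCoeff u m′) q ≡ sumBy (λ u → termCoeff u m′) q′
    same-coeff = trans (sym (coeff≡sumBy-termCoeff q m′)) (trans (q≈q′ m′) (coeff≡sumBy-termCoeff q′ m′))
  ... | no e∤m = trans (vanishes q) (sym (vanishes q′))
    where
    vanishes : ∀ q → rowCoeff (c , e) q m ≡ 0ℚ
    vanishes q = trans (sumBy-cong (termCoeff-*ₜ-∤ c e∤m) q) (sumBy-zero q)

  ≋-refl : {p : Poly n} → p ≋ p
  ≋-refl = coeffwise λ _ → refl

  ≋-sym : {p q : Poly n} → p ≋ q → q ≋ p
  ≋-sym (coeffwise p≈q) = coeffwise λ m → sym (p≈q m)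

  ≋-trans : {p q r : Poly n} → p ≋ q → q ≋ r → p ≋ r
  ≋-trans (coeffwise p≈q) (coeffwise q≈r) = coeffwise λ m → trans (p≈q m) (q≈r m)

  ≋-isEquivalence : IsEquivalence (_≋_ {n})
  ≋-isEquivalence = record { refl = ≋-refl ; sym = ≋-sym ; trans = ≋-trans }

  ⊕-cong : {p p′ q q′ : Poly n} → p ≋ p′ → q ≋ q′ → p ⊕ q ≋ p′ ⊕ q′
  ⊕-cong {p} {p′} {q} {q′} (coeffwise p≈p′) (coeffwise q≈q′) = coeffwise λ m →
    trans (coeff-⊕ p q m) (trans (cong₂ ℚ._+_ (p≈p′ m) (q≈q′ m)) (sym (coeff-⊕ p′ q′ m)))

  ⊕-congˡ : ∀ (p : Poly n) {q q′} → q ≋ q′ → p ⊕ q ≋ p ⊕ q′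
  ⊕-congˡ p = ⊕-cong ≋-refl

  ⊕-congʳ : ∀ (q : Poly n) {p p′} → p ≋ p′ → p ⊕ q ≋ p′ ⊕ q
  ⊕-congʳ q p≋p′ = ⊕-cong p≋p′ ≋-refl

  ⊕-assoc : ∀ (p q r : Poly n) → (p ⊕ q) ⊕ r ≋ p ⊕ (q ⊕ r)
  ⊕-assoc p q r = coeffwise λ m → cong (λ s → coeff s m) (List.++-assoc p q r)

  ⊕-comm : ∀ (p q : Poly n) → p ⊕ q ≋ q ⊕ p
  ⊕-comm p q = coeffwise λ m →
    trans (coeff-⊕ p q m) (trans (ℚ.+-comm (coeff p m) (coeff q m)) (sym (coeff-⊕ q p m)))

  ⊕-identityʳ : ∀ (p : Poly n) → p ⊕ zeroP ≋ p
  ⊕-identityʳ p = coeffwise λ m → cong (λ s → coeff s m) (List.++-identityʳ p)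

  negP-cong : {p q : Poly n} → p ≋ q → negP p ≋ negP q
  negP-cong {p} {q} (coeffwise p≈q) = coeffwise λ m →
    trans (coeff-negP p m) (trans (cong ℚ.-_ (p≈q m)) (sym (coeff-negP q m)))

  ⊕-inverseˡ : ∀ (p : Poly n) → negP p ⊕ p ≋ zeroP
  ⊕-inverseˡ p = coeffwise λ m → trans (coeff-⊕ (negP p) p m)
    (trans (cong (ℚ._+ coeff p m) (coeff-negP p m)) (ℚ.+-inverseˡ (coeff p m)))

  ⊕-inverseʳ : ∀ (p : Poly n) → p ⊕ negP p ≋ zeroP
  ⊕-inverseʳ p = ≋-trans (⊕-comm p (negP p)) (⊕-inverseˡ p)

  ⊗-congˡ : ∀ (p : Poly n) {q q′} → q ≋ q′ → p ⊗ q ≋ p ⊗ q′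
  ⊗-congˡ p {q} {q′} q≋q′ = coeffwise λ m →
    trans (coeff-⊗ p q m) (trans (sumBy-cong (λ t → rowCoeff-cong t q≋q′ m) p) (sym (coeff-⊗ p q′ m)))

  ⊗-comm : ∀ (p q : Poly n) → p ⊗ q ≋ q ⊗ p
  ⊗-comm p q = coeffwise λ m → begin
    coeff (p ⊗ q) m
      ≡⟨ coeff-⊗ p q m ⟩
    sumBy (λ t → sumBy (λ u → termCoeff (t *ₜ u) m) q) p
      ≡⟨ sumBy-swap _ p q ⟩
    sumBy (λ u → sumBy (λ t → termCoeff (t *ₜ u) m) p) q
      ≡⟨ sumBy-cong (λ u → sumBy-cong (λ t → cong (λ v → termCoeff v m) (*ₜ-comm t u)) p) q ⟩
    sumBy (λ u → rowCoeff u p m) q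
      ≡⟨ sym (coeff-⊗ q p m) ⟩
    coeff (q ⊗ p) m
      ∎
    where open ≡-Reasoning

  ⊗-cong : {p p′ q q′ : Poly n} → p ≋ p′ → q ≋ q′ → p ⊗ q ≋ p′ ⊗ q′
  ⊗-cong {p} {p′} {q} {q′} p≋p′ q≋q′ =
    ≋-trans (⊗-congˡ p q≋q′) (≋-trans (⊗-comm p q′) (≋-trans (⊗-congˡ q′ p≋p′) (⊗-comm q′ p′)))

  ⊗-assoc : ∀ (p q r : Poly n) → (p ⊗ q) ⊗ r ≋ p ⊗ (q ⊗ r)
  ⊗-assoc p q r = coeffwise λ m → begin
    coeff ((p ⊗ q) ⊗ r) m
      ≡⟨ coeff-⊗ (p ⊗ q) r m ⟩
    sumBy (λ v → rowCoeff v r m) (p ⊗ q)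
      ≡⟨ sumBy-⊗ _ p q ⟩
    sumBy (λ t → sumBy (λ u → sumBy (λ w → termCoeff ((t *ₜ u) *ₜ w) m) r) q) p
      ≡⟨ sumBy-cong (λ t → sumBy-cong (λ u → sumBy-cong (λ w →
           cong (λ v → termCoeff v m) (*ₜ-assoc t u w)) r) q) p ⟩
    sumBy (λ t → sumBy (λ u → sumBy (λ w → termCoeff (t *ₜ (u *ₜ w)) m) r) q) p
      ≡⟨ sumBy-cong (λ t → sym (sumBy-⊗ (λ v → termCoeff (t *ₜ v) m) q r)) p ⟩
    sumBy (λ t → rowCoeff t (q ⊗ r) m) p
      ≡⟨ sym (coeff-⊗ p (q ⊗ r) m) ⟩
    coeff (p ⊗ (q ⊗ r)) m
      ∎
    where open ≡-Reasoning

  ⊗-distribʳ : ∀ (p q r : Poly n) → (q ⊕ r) ⊗ p ≋ (q ⊗ p) ⊕ (r ⊗ p)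
  ⊗-distribʳ p q r = coeffwise λ m → begin
    coeff ((q ⊕ r) ⊗ p) m
      ≡⟨ coeff-⊗ (q ⊕ r) p m ⟩
    sumBy (λ t → rowCoeff t p m) (q ++ r)
      ≡⟨ sumBy-++ _ q r ⟩
    sumBy (λ t → rowCoeff t p m) q ℚ.+ sumBy (λ t → rowCoeff t p m) r
      ≡⟨ sym (cong₂ ℚ._+_ (coeff-⊗ q p m) (coeff-⊗ r p m)) ⟩
    coeff (q ⊗ p) m ℚ.+ coeff (r ⊗ p) m
      ≡⟨ sym (coeff-⊕ (q ⊗ p) (r ⊗ p) m) ⟩
    coeff ((q ⊗ p) ⊕ (r ⊗ p)) m
      ∎
    where open ≡-Reasoning

  ⊗-distribˡ : ∀ (p q r : Poly n) → p ⊗ (q ⊕ r) ≋ (p ⊗ q) ⊕ (p ⊗ r)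
  ⊗-distribˡ p q r = ≋-trans (⊗-comm p (q ⊕ r))
    (≋-trans (⊗-distribʳ p q r) (⊕-cong (⊗-comm q p) (⊗-comm r p)))

  ⊗-identityˡ : ∀ (p : Poly n) → constP 1ℚ ⊗ p ≋ p
  ⊗-identityˡ p = coeffwise λ m → trans (coeff-⊗ (constP 1ℚ) p m) (trans (ℚ.+-identityʳ _)
    (trans (sumBy-cong (λ t → cong (λ v → termCoeff v m) (1*ₜ t)) p) (sym (coeff≡sumBy-termCoeff p m))))
    where
    1*ₜ : ∀ t → (1ℚ , Vec.replicate n 0) *ₜ t ≡ t
    1*ₜ (c , e) = cong₂ _,_ (ℚ.*-identityˡ c) (Vec.zipWith-identityˡ ℕ.+-identityˡ e)

  ⊗-identityʳ : ∀ (p : Poly n) → p ⊗ constP 1ℚ ≋ p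
  ⊗-identityʳ p = ≋-trans (⊗-comm p (constP 1ℚ)) (⊗-identityˡ p)

  constP-+ : ∀ a b → constP {n} (a ℚ.+ b) ≋ constP a ⊕ constP b
  constP-+ a b = coeffwise λ m → trans (split m) (sym (coeff-⊕ (constP a) (constP b) m))
    where
    split : ∀ m → coeff (constP {n} (a ℚ.+ b)) m ≡ coeff (constP {n} a) m ℚ.+ coeff (constP {n} b) m
    split m with ≡-dec ℕ._≟_ (Vec.replicate n 0) m
    ... | yes _ = trans (ℚ.+-identityʳ _) (sym (cong₂ ℚ._+_ (ℚ.+-identityʳ a) (ℚ.+-identityʳ b)))
    ... | no  _ = refl

  constP-* : ∀ a b → constP {n} (a ℚ.* b) ≋ constP a ⊗ constP b
  constP-* a b = coeffwise λ m →
    cong (λ e → coeff ((a ℚ.* b , e) ∷ []) m) (sym (Vec.zipWith-identityˡ ℕ.+-identityˡ (Vec.replicate n 0)))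

  constP-0 : constP {n} 0ℚ ≋ zeroP
  constP-0 = coeffwise vanishes
    where
    vanishes : ∀ m → coeff (constP {n} 0ℚ) m ≡ 0ℚ
    vanishes m with ≡-dec ℕ._≟_ (Vec.replicate n 0) m
    ... | yes _ = refl
    ... | no  _ = refl

polyCommutativeRing : ℕ → CommutativeRing 0ℓ 0ℓ
polyCommutativeRing n = record
  { Carrier = Poly n ; _≈_ = _≋_ ; _+_ = _⊕_ ; _*_ = _⊗_ ; -_ = negP ; 0# = zeroP ; 1# = constP 1ℚ
  ; isCommutativeRing = record
    { isRing = record
      { +-isAbelianGroup = record
        { isGroup = record
          { isMonoid = record
            { isSemigroup = record
              { isMagma = record { isEquivalence = ≋-isEquivalence ; ∙-cong = ⊕-cong }
              ; assoc = ⊕-assoc }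
            ; identity = (λ _ → ≋-refl) , ⊕-identityʳ }
          ; inverse = ⊕-inverseˡ , ⊕-inverseʳ
          ; ⁻¹-cong = negP-cong }
        ; comm = ⊕-comm }
      ; *-cong = ⊗-cong
      ; *-assoc = ⊗-assoc
      ; *-identity = ⊗-identityˡ , ⊗-identityʳ
      ; distrib = ⊗-distribˡ , ⊗-distribʳ }
    ; *-comm = ⊗-comm } }

module PolySolver (n : ℕ) where
  open import Algebra.Solver.Ring.AlmostCommutativeRing

  constP-morphism : ℚ.+-*-rawRing -Raw-AlmostCommutative⟶ fromCommutativeRing (polyCommutativeRing n)
  constP-morphism = record
    { ⟦_⟧ = constP ; +-homo = constP-+ ; *-homo = constP-* ; -‿homo = λ _ → ≋-refl
    ; 0-homo = constP-0 ; 1-homo = ≋-refl }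

  constP-≟ : WeaklyDecidable (Induced-equivalence constP-morphism)
  constP-≟ a b with a ℚ.≟ b
  ... | yes refl = just ≋-refl
  ... | no  _    = nothing

  open import Algebra.Solver.Ring
    ℚ.+-*-rawRing (fromCommutativeRing (polyCommutativeRing n)) constP-morphism constP-≟ public

sumSq : ∀ {n} → List (Poly n) → Poly n
sumSq S = sumP (List.map (λ s → s ⊗ s) S)

module _ {n : ℕ} where

  ⊗-zeroʳ : ∀ (p : Poly n) → p ⊗ zeroP ≡ zeroP
  ⊗-zeroʳ []      = refl
  ⊗-zeroʳ (t ∷ p) = ⊗-zeroʳ p

  sumSq-++ : ∀ (S T : List (Poly n)) → sumSq (S ++ T) ≋ sumSq S ⊕ sumSq T
  sumSq-++ []      T = ≋-refl
  sumSq-++ (s ∷ S) T =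
    ≋-trans (⊕-congˡ (s ⊗ s) (sumSq-++ S T)) (≋-sym (⊕-assoc (s ⊗ s) (sumSq S) (sumSq T)))

  sumSq-map-⊗ : ∀ (y : Poly n) S → sumSq (List.map (y ⊗_) S) ≋ (y ⊗ y) ⊗ sumSq S
  sumSq-map-⊗ y []      = coeffwise λ m → cong (λ p → coeff p m) (sym (⊗-zeroʳ (y ⊗ y)))
  sumSq-map-⊗ y (s ∷ S) =
    ≋-trans (⊕-congˡ ((y ⊗ s) ⊗ (y ⊗ s)) (sumSq-map-⊗ y S)) (factor y s (sumSq S))
    where
    open PolySolver n using (solve; _:+_; _:*_; _:=_)
    factor : ∀ y s w → (y ⊗ s) ⊗ (y ⊗ s) ⊕ (y ⊗ y) ⊗ w ≋ (y ⊗ y) ⊗ (s ⊗ s ⊕ w)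
    factor = solve 3 (λ y s w → (y :* s) :* (y :* s) :+ (y :* y) :* w := (y :* y) :* ((s :* s) :+ w)) ≋-refl

  sumSq-pair : ∀ (s t : Poly n) → s ⊗ s ⊕ t ⊗ t ≋ sumSq (s ∷ t ∷ [])
  sumSq-pair s t = ⊕-congˡ (s ⊗ s) (≋-sym (⊕-identityʳ (t ⊗ t)))

TermsDegLE : ∀ {n} → Poly n → ℕ → Set
TermsDegLE p t = All (λ term → mdeg (proj₂ term) ℕ.≤ t) p

mdeg-+ₘ : ∀ {n} (e e′ : Mono n) → mdeg (e +ₘ e′) ≡ mdeg e ℕ.+ mdeg e′
mdeg-+ₘ []      []        = refl
mdeg-+ₘ (a ∷ e) (b ∷ e′) =
  trans (cong (a ℕ.+ b ℕ.+_) (mdeg-+ₘ e e′)) (ℕ-interchange a b (mdeg e) (mdeg e′))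
  where
  open CommutativeSemigroupProperties ℕ.+-commutativeSemigroup using () renaming (interchange to ℕ-interchange)

mdeg-replicate-0 : ∀ n → mdeg (Vec.replicate n 0) ≡ 0
mdeg-replicate-0 zero    = refl
mdeg-replicate-0 (suc n) = mdeg-replicate-0 n

mdeg-varP : ∀ {n} (j : Fin n) → mdeg (Vec.updateAt (Vec.replicate n 0) j (λ _ → 1)) ≡ 1
mdeg-varP {suc n} Fin.zero    = cong suc (mdeg-replicate-0 n)
mdeg-varP {suc n} (Fin.suc j) = mdeg-varP j

module _ {n : ℕ} where

  termsDegLE-mono : ∀ {p : Poly n} {s t} → s ℕ.≤ t → TermsDegLE p s → TermsDegLE p t
  termsDegLE-mono s≤t = All.map (λ d≤s → ℕ.≤-trans d≤s s≤t)

  termsDegLE-⊕ : ∀ {p q : Poly n} {t} → TermsDegLE p t → TermsDegLE q t → TermsDegLE (p ⊕ q) t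
  termsDegLE-⊕ = All.++⁺

  termsDegLE-negP : ∀ {p : Poly n} {t} → TermsDegLE p t → TermsDegLE (negP p) t
  termsDegLE-negP = All.map⁺

  termsDegLE-constP : ∀ c {t} → TermsDegLE (constP {n} c) t
  termsDegLE-constP c = ℕ.≤-trans (ℕ.≤-reflexive (mdeg-replicate-0 n)) ℕ.z≤n ∷ []

  termsDegLE-varP : ∀ (j : Fin n) → TermsDegLE (varP j) 1
  termsDegLE-varP j = ℕ.≤-reflexive (mdeg-varP j) ∷ []

  termsDegLE-⊗ : ∀ {p q : Poly n} {s t} → TermsDegLE p s → TermsDegLE q t → TermsDegLE (p ⊗ q) (s ℕ.+ t)
  termsDegLE-⊗ {[]}          []           q≤t = []
  termsDegLE-⊗ {(c , e) ∷ p} {s = s} {t} (e≤s ∷ p≤s) q≤t =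
    All.++⁺ (All.map⁺ (row q≤t)) (termsDegLE-⊗ p≤s q≤t)
    where
    row : ∀ {q : Poly n} → TermsDegLE q t → All (λ term → mdeg (e +ₘ proj₂ term) ℕ.≤ s ℕ.+ t) q
    row = All.map (λ e′≤t → ℕ.≤-trans (ℕ.≤-reflexive (mdeg-+ₘ e _)) (ℕ.+-mono-≤ e≤s e′≤t))

  termsDegLE⇒DegLE : ∀ {p : Poly n} {t} → TermsDegLE p t → DegLE p t
  termsDegLE⇒DegLE {[]}          []           m c≢0 = ⊥-elim (c≢0 refl)
  termsDegLE⇒DegLE {(c , e) ∷ p} (e≤t ∷ p≤t) m c≢0 with ≡-dec ℕ._≟_ e m
  ... | yes refl = e≤t
  ... | no  _    = termsDegLE⇒DegLE p≤t m c≢0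

  DegLE-resp-≋ : ∀ {p q : Poly n} {t} → p ≋ q → DegLE p t → DegLE q t
  DegLE-resp-≋ (coeffwise p≈q) p≤t m q≢0 = p≤t m (λ p≡0 → q≢0 (trans (sym (p≈q m)) p≡0))

coeffs : ∀ {n} → Poly n → List ℚ
coeffs = List.map proj₁

norm₁ : ∀ {n} → Poly n → ℚ
norm₁ p = sumBy ℚ.∣_∣ (coeffs p)

norm₁-nonNeg : ∀ {n} (p : Poly n) → 0ℚ ≤ norm₁ p
norm₁-nonNeg p = sumBy-nonNeg ℚ.∣_∣ ℚ.0≤∣p∣ (coeffs p)

∣coeff∣≤norm₁ : ∀ {n} (p : Poly n) m → ℚ.∣ coeff p m ∣ ≤ norm₁ p
∣coeff∣≤norm₁ []            m = ℚ.≤-refl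
∣coeff∣≤norm₁ ((c , e) ∷ p) m with ≡-dec ℕ._≟_ e m
... | yes _ = ℚ.≤-trans (ℚ.∣p+q∣≤∣p∣+∣q∣ c (coeff p m)) (ℚ.+-monoʳ-≤ ℚ.∣ c ∣ (∣coeff∣≤norm₁ p m))
... | no  _ = ℚ.≤-trans (∣coeff∣≤norm₁ p m) (p≤q+p (ℚ.0≤∣p∣ c))

all-CoeffLE : ∀ {n} (S : List (Poly n)) {B} → sumBy norm₁ S ≤ B → All (λ s → CoeffLE s B) S
all-CoeffLE []      _    = []
all-CoeffLE (s ∷ S) ΣS≤B =
  (λ m → ℚ.≤-trans (∣coeff∣≤norm₁ s m) (ℚ.≤-trans (p≤p+q (sumBy-nonNeg norm₁ norm₁-nonNeg S)) ΣS≤B))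
  ∷ all-CoeffLE S (ℚ.≤-trans (p≤q+p (norm₁-nonNeg s)) ΣS≤B)

allProducts : List ℚ → List ℚ → List ℚ
allProducts cs ds = List.concatMap (λ c → List.map (c ℚ.*_) ds) cs

coeffs-⊗ : ∀ {n} (p q : Poly n) → coeffs (p ⊗ q) ≡ allProducts (coeffs p) (coeffs q)
coeffs-⊗ []            q = refl
coeffs-⊗ ((c , e) ∷ p) q = trans (List.map-++ proj₁ (List.map _ q) (p ⊗ q))
  (cong₂ _++_ (trans (sym (List.map-∘ q)) (List.map-∘ q)) (coeffs-⊗ p q))

SameCoeffs : ∀ {n n′} → Poly n → Poly n′ → Set
SameCoeffs p p′ = coeffs p ≡ coeffs p′

module _ {n n′ : ℕ} where

  sameCoeffs-⊗ : {p q : Poly n} {p′ q′ : Poly n′} →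
                 SameCoeffs p p′ → SameCoeffs q q′ → SameCoeffs (p ⊗ q) (p′ ⊗ q′)
  sameCoeffs-⊗ {p} {q} {p′} {q′} p∼p′ q∼q′ =
    trans (coeffs-⊗ p q) (trans (cong₂ allProducts p∼p′ q∼q′) (sym (coeffs-⊗ p′ q′)))

  sumBy-norm₁-cong : {S : List (Poly n)} {S′ : List (Poly n′)} →
                     Pointwise SameCoeffs S S′ → sumBy norm₁ S ≡ sumBy norm₁ S′
  sumBy-norm₁-cong []            = refl
  sumBy-norm₁-cong (s∼s′ ∷ S∼S′) = cong₂ ℚ._+_ (cong (sumBy ℚ.∣_∣) s∼s′) (sumBy-norm₁-cong S∼S′)

-- The certificate

squareBound : ∀ {m} → Vec ℚ m → ℚ
squareBound []      = 0ℚ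
squareBound (r ∷ ρ) = r ℚ.* r ℚ.+ (b ℚ.+ 1ℚ) ℚ.* (b ℚ.+ 1ℚ) ℚ.+ (r ℚ.* b) ℚ.* (r ℚ.* b)
  where b = squareBound ρ ℚ.* ℚ.½

half+half : ∀ q → q ℚ.* ℚ.½ ℚ.+ q ℚ.* ℚ.½ ≡ q
half+half = solve 1 (λ q → q :* con ℚ.½ :+ q :* con ℚ.½ := q) refl
  where open ℚ-Solver

q*q-nonNeg : ∀ q → 0ℚ ≤ q ℚ.* q
q*q-nonNeg q = subst (0ℚ ≤_) (trans (ℚ.∣p*q∣≡∣p∣*∣q∣ q q) (sym q*q≡∣q∣*∣q∣)) (ℚ.0≤∣p∣ (q ℚ.* q))
  where
  q*q≡∣q∣*∣q∣ : q ℚ.* q ≡ ℚ.∣ q ∣ ℚ.* ℚ.∣ q ∣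
  q*q≡∣q∣*∣q∣ with ℚ.∣p∣≡p∨∣p∣≡-p q
  ... | inj₁ ∣q∣≡q  = cong (λ c → c ℚ.* c) (sym ∣q∣≡q)
  ... | inj₂ ∣q∣≡-q = trans (solve 1 (λ p → p :* p := (:- p) :* (:- p)) refl q)
                            (cong (λ c → c ℚ.* c) (sym ∣q∣≡-q))
    where open ℚ-Solver

squareBound-nonNeg : ∀ {m} (ρ : Vec ℚ m) → 0ℚ ≤ squareBound ρ
squareBound-nonNeg []      = ℚ.≤-refl
squareBound-nonNeg (r ∷ ρ) =
  ℚ.+-mono-≤ (ℚ.+-mono-≤ (q*q-nonNeg r) (q*q-nonNeg (b ℚ.+ 1ℚ))) (q*q-nonNeg (r ℚ.* b))
  where b = squareBound ρ ℚ.* ℚ.½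

module Certificate {n : ℕ} (j : Fin n) where
  open PolySolver n using (solve; _:+_; _:*_; _:-_; con; _:=_)
  open import Relation.Binary.Reasoning.Setoid (CommutativeRing.setoid (polyCommutativeRing n))
  open CommutativeSemigroupProperties (CommutativeRing.+-commutativeSemigroup (polyCommutativeRing n))
    using (xy∙z≈xz∙y)

  x : Poly n
  x = varP j

  linearFactor : ℚ → Poly n
  linearFactor r = x ⊕ constP (ℚ.- r)

  peeledSquares : ℚ → ℚ → List (Poly n)
  peeledSquares r b = linearFactor r ⊗ x ⊕ negP (constP b ⊕ constP 1ℚ)
                    ∷ linearFactor r ⊕ constP r ⊗ constP b
                    ∷ []

  squares : ∀ {m} → Vec ℚ m → List (Poly n)
  squares []      = []
  squares (r ∷ ρ) = List.map (linearFactor r ⊗_) (squares ρ) ++ peeledSquares r (squareBound ρ ℚ.* ℚ.½)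

  multiplier : ∀ {m} → Vec ℚ m → Poly n
  multiplier []      = negP (x ⊗ x)
  multiplier (r ∷ ρ) = linearFactor r ⊗ multiplier ρ

  constP-squareBound : ∀ r {m} (ρ : Vec ℚ m) →
    let R = constP {n} r ; B = constP {n} (squareBound ρ ℚ.* ℚ.½) in
    constP (squareBound (r ∷ ρ)) ≋ R ⊗ R ⊕ (B ⊕ constP 1ℚ) ⊗ (B ⊕ constP 1ℚ) ⊕ (R ⊗ B) ⊗ (R ⊗ B)
  constP-squareBound r ρ =
    ≋-trans (constP-+ (r ℚ.* r ℚ.+ b+1 ℚ.* b+1) (rb ℚ.* rb))
      (⊕-cong (≋-trans (constP-+ (r ℚ.* r) (b+1 ℚ.* b+1))
                (⊕-cong (constP-* r r) (≋-trans (constP-* b+1 b+1) (⊗-cong (constP-+ b 1ℚ) (constP-+ b 1ℚ)))))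
              (≋-trans (constP-* rb rb) (⊗-cong (constP-* r b) (constP-* r b))))
    where
    b = squareBound ρ ℚ.* ℚ.½
    b+1 = b ℚ.+ 1ℚ
    rb = r ℚ.* b

  -- With y = x - r:  r² + (b+1)² + (rb)² - x² = y²(2b - x²) + (yx - b - 1)² + (y + rb)².
  -- With b = M/2 it turns M - x² ≡ SoS mod D into r² + (b+1)² + (rb)² - x² ≡ SoS mod (x - r)D.
  peel : ∀ X R B →
    (R ⊗ R ⊕ (B ⊕ constP 1ℚ) ⊗ (B ⊕ constP 1ℚ) ⊕ (R ⊗ B) ⊗ (R ⊗ B)) ⊕ negP (X ⊗ X) ≋
    ((X ⊕ negP R) ⊗ (X ⊕ negP R)) ⊗ ((B ⊕ B) ⊕ negP (X ⊗ X))
      ⊕ (((X ⊕ negP R) ⊗ X ⊕ negP (B ⊕ constP 1ℚ)) ⊗ ((X ⊕ negP R) ⊗ X ⊕ negP (B ⊕ constP 1ℚ))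
         ⊕ ((X ⊕ negP R) ⊕ R ⊗ B) ⊗ ((X ⊕ negP R) ⊕ R ⊗ B))
  peel = solve 3 (λ X R B →
    (R :* R :+ (B :+ con 1ℚ) :* (B :+ con 1ℚ) :+ (R :* B) :* (R :* B)) :- X :* X :=
    ((X :- R) :* (X :- R)) :* ((B :+ B) :- X :* X)
      :+ (((X :- R) :* X :- (B :+ con 1ℚ)) :* ((X :- R) :* X :- (B :+ con 1ℚ))
         :+ ((X :- R) :+ R :* B) :* ((X :- R) :+ R :* B))) ≋-refl

  regroup : ∀ Y S H D T → (Y ⊗ Y) ⊗ (S ⊕ H ⊗ D) ⊕ T ≋ ((Y ⊗ Y) ⊗ S ⊕ T) ⊕ (Y ⊗ H) ⊗ (Y ⊗ D)
  regroup = solve 5 (λ Y S H D T →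
    (Y :* Y) :* (S :+ H :* D) :+ T := ((Y :* Y) :* S :+ T) :+ (Y :* H) :* (Y :* D)) ≋-refl

  squareBound-certificate : ∀ {m} (ρ : Vec ℚ m) →
    constP (squareBound ρ) ⊕ negP (x ⊗ x) ≋ sumSq (squares ρ) ⊕ multiplier ρ ⊗ domainPoly ρ j
  squareBound-certificate []      = ⊕-cong constP-0 (≋-sym (⊗-identityʳ (negP (x ⊗ x))))
  squareBound-certificate (r ∷ ρ) = begin
    constP (squareBound (r ∷ ρ)) ⊕ negP (x ⊗ x)
      ≈⟨ ⊕-congʳ (negP (x ⊗ x)) (constP-squareBound r ρ) ⟩
    (R ⊗ R ⊕ (B ⊕ constP 1ℚ) ⊗ (B ⊕ constP 1ℚ) ⊕ (R ⊗ B) ⊗ (R ⊗ B)) ⊕ negP (x ⊗ x)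
      ≈⟨ peel x R B ⟩
    (Y ⊗ Y) ⊗ ((B ⊕ B) ⊕ negP (x ⊗ x)) ⊕ (s₁ ⊗ s₁ ⊕ s₂ ⊗ s₂)
      ≈⟨ ⊕-cong (⊗-congˡ (Y ⊗ Y) (≋-trans (⊕-congʳ (negP (x ⊗ x)) B+B≋M) (squareBound-certificate ρ)))
                (sumSq-pair s₁ s₂) ⟩
    (Y ⊗ Y) ⊗ (sumSq (squares ρ) ⊕ multiplier ρ ⊗ domainPoly ρ j) ⊕ sumSq (peeledSquares r b)
      ≈⟨ regroup Y (sumSq (squares ρ)) (multiplier ρ) (domainPoly ρ j) (sumSq (peeledSquares r b)) ⟩
    ((Y ⊗ Y) ⊗ sumSq (squares ρ) ⊕ sumSq (peeledSquares r b)) ⊕ multiplier (r ∷ ρ) ⊗ domainPoly (r ∷ ρ) j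
      ≈⟨ ⊕-congʳ (multiplier (r ∷ ρ) ⊗ domainPoly (r ∷ ρ) j)
           (≋-sym (≋-trans (sumSq-++ (List.map (Y ⊗_) (squares ρ)) (peeledSquares r b))
                           (⊕-congʳ (sumSq (peeledSquares r b)) (sumSq-map-⊗ Y (squares ρ))))) ⟩
    sumSq (squares (r ∷ ρ)) ⊕ multiplier (r ∷ ρ) ⊗ domainPoly (r ∷ ρ) j
      ∎
    where
    b = squareBound ρ ℚ.* ℚ.½
    R = constP r
    B = constP b
    Y = linearFactor r
    s₁ = Y ⊗ x ⊕ negP (B ⊕ constP 1ℚ)
    s₂ = Y ⊕ R ⊗ B
    B+B≋M : B ⊕ B ≋ constP (squareBound ρ)
    B+B≋M = ≋-trans (≋-sym (constP-+ b b))
                    (coeffwise λ m → cong (λ c → coeff (constP c) m) (half+half (squareBound ρ)))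

  squareBound-certificate-++ : ∀ {m} (ρ : Vec ℚ m) T {q} →
    q ≋ (constP (squareBound ρ) ⊕ negP (x ⊗ x)) ⊕ sumSq T →
    q ≋ sumSq (squares ρ ++ T) ⊕ multiplier ρ ⊗ domainPoly ρ j
  squareBound-certificate-++ ρ T {q} q≋ = begin
    q
      ≈⟨ q≋ ⟩
    (constP (squareBound ρ) ⊕ negP (x ⊗ x)) ⊕ sumSq T
      ≈⟨ ⊕-congʳ (sumSq T) (squareBound-certificate ρ) ⟩
    (sumSq (squares ρ) ⊕ multiplier ρ ⊗ domainPoly ρ j) ⊕ sumSq T
      ≈⟨ xy∙z≈xz∙y (sumSq (squares ρ)) (multiplier ρ ⊗ domainPoly ρ j) (sumSq T) ⟩
    (sumSq (squares ρ) ⊕ sumSq T) ⊕ multiplier ρ ⊗ domainPoly ρ j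
      ≈⟨ ⊕-congʳ (multiplier ρ ⊗ domainPoly ρ j) (≋-sym (sumSq-++ (squares ρ) T)) ⟩
    sumSq (squares ρ ++ T) ⊕ multiplier ρ ⊗ domainPoly ρ j
      ∎

  tailSquares : ℚ → List (Poly n)
  tailSquares ε = x ⊕ constP ε ∷ constP ℚ.½ ∷ []

  upperBound-identity : ∀ M →
    constP (M ℚ.+ ℚ.½) ⊕ negP x ≋ (constP M ⊕ negP (x ⊗ x)) ⊕ sumSq (tailSquares ℚ.-½)
  upperBound-identity M = ≋-trans (⊕-congʳ (negP x) (constP-+ M ℚ.½))
    (≋-trans (complete (constP M) x)
             (⊕-congˡ (constP M ⊕ negP (x ⊗ x)) (sumSq-pair (x ⊕ constP ℚ.-½) (constP ℚ.½))))
    where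
    complete : ∀ M X → (M ⊕ constP ℚ.½) ⊕ negP X ≋
               (M ⊕ negP (X ⊗ X)) ⊕ ((X ⊕ constP ℚ.-½) ⊗ (X ⊕ constP ℚ.-½) ⊕ constP ℚ.½ ⊗ constP ℚ.½)
    complete = solve 2 (λ M X → (M :+ con ℚ.½) :- X :=
      (M :- X :* X) :+ ((X :+ con ℚ.-½) :* (X :+ con ℚ.-½) :+ con ℚ.½ :* con ℚ.½)) ≋-refl

  lowerBound-identity : ∀ M →
    constP (M ℚ.+ ℚ.½) ⊕ x ≋ (constP M ⊕ negP (x ⊗ x)) ⊕ sumSq (tailSquares ℚ.½)
  lowerBound-identity M = ≋-trans (⊕-congʳ x (constP-+ M ℚ.½))
    (≋-trans (complete (constP M) x)
             (⊕-congˡ (constP M ⊕ negP (x ⊗ x)) (sumSq-pair (x ⊕ constP ℚ.½) (constP ℚ.½))))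
    where
    complete : ∀ M X → (M ⊕ constP ℚ.½) ⊕ X ≋
               (M ⊕ negP (X ⊗ X)) ⊕ ((X ⊕ constP ℚ.½) ⊗ (X ⊕ constP ℚ.½) ⊕ constP ℚ.½ ⊗ constP ℚ.½)
    complete = solve 2 (λ M X → (M :+ con ℚ.½) :+ X :=
      (M :- X :* X) :+ ((X :+ con ℚ.½) :* (X :+ con ℚ.½) :+ con ℚ.½ :* con ℚ.½)) ≋-refl

  linearFactor-deg : ∀ r → TermsDegLE (linearFactor r) 1
  linearFactor-deg r = termsDegLE-⊕ (termsDegLE-varP j) (termsDegLE-constP (ℚ.- r))

  peeledSquares-deg : ∀ r b {t} → All (λ s → TermsDegLE s (2 ℕ.+ t)) (peeledSquares r b)
  peeledSquares-deg r b =
    termsDegLE-⊕ (termsDegLE-mono (ℕ.m≤m+n 2 _) (termsDegLE-⊗ (linearFactor-deg r) (termsDegLE-varP j)))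
                 (termsDegLE-negP (termsDegLE-⊕ (termsDegLE-constP b) (termsDegLE-constP 1ℚ)))
    ∷ termsDegLE-⊕ (termsDegLE-mono (ℕ.s≤s ℕ.z≤n) (linearFactor-deg r))
                   (termsDegLE-⊗ {s = 0} (termsDegLE-constP r) (termsDegLE-constP b))
    ∷ []

  squares-deg : ∀ {m} (ρ : Vec ℚ m) → All (λ s → TermsDegLE s (suc m)) (squares ρ)
  squares-deg []      = []
  squares-deg (r ∷ ρ) =
    All.++⁺ (All.map⁺ (All.map (termsDegLE-⊗ (linearFactor-deg r)) (squares-deg ρ))) (peeledSquares-deg r _)

  tailSquares-deg : ∀ ε {t} → All (λ s → TermsDegLE s (suc t)) (tailSquares ε)
  tailSquares-deg ε = termsDegLE-⊕ (termsDegLE-mono (ℕ.s≤s ℕ.z≤n) (termsDegLE-varP j)) (termsDegLE-constP ε)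
                    ∷ termsDegLE-constP ℚ.½
                    ∷ []

  multiplier-deg : ∀ {m} (ρ : Vec ℚ m) → TermsDegLE (multiplier ρ) (2 ℕ.+ m)
  multiplier-deg []      = termsDegLE-negP (termsDegLE-⊗ (termsDegLE-varP j) (termsDegLE-varP j))
  multiplier-deg (r ∷ ρ) = termsDegLE-⊗ (linearFactor-deg r) (multiplier-deg ρ)

  domainPoly-deg : ∀ {m} (ρ : Vec ℚ m) → TermsDegLE (domainPoly ρ j) m
  domainPoly-deg []      = termsDegLE-constP 1ℚ
  domainPoly-deg (r ∷ ρ) = termsDegLE-⊗ (linearFactor-deg r) (domainPoly-deg ρ)

module _ {n n′ : ℕ} (i : Fin n) (j : Fin n′) where
  private
    module Cᵢ = Certificate i
    module Cⱼ = Certificate j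

  linearFactor-sameCoeffs : ∀ r → SameCoeffs (Cᵢ.linearFactor r) (Cⱼ.linearFactor r)
  linearFactor-sameCoeffs r = refl

  squares-sameCoeffs : ∀ {m} (ρ : Vec ℚ m) → Pointwise SameCoeffs (Cᵢ.squares ρ) (Cⱼ.squares ρ)
  squares-sameCoeffs []      = []
  squares-sameCoeffs (r ∷ ρ) =
    Pointwise.++⁺ (Pointwise.map⁺ _ _ (Pointwise.map (sameCoeffs-⊗ (linearFactor-sameCoeffs r))
                                                     (squares-sameCoeffs ρ)))
                  (refl ∷ refl ∷ [])

  multiplier-sameCoeffs : ∀ {m} (ρ : Vec ℚ m) → SameCoeffs (Cᵢ.multiplier ρ) (Cⱼ.multiplier ρ)
  multiplier-sameCoeffs []      = refl
  multiplier-sameCoeffs (r ∷ ρ) = sameCoeffs-⊗ (linearFactor-sameCoeffs r) (multiplier-sameCoeffs ρ)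

  certificate-sameNorms : ∀ {m} (ρ : Vec ℚ m) ε →
    sumBy norm₁ (Cᵢ.squares ρ ++ Cᵢ.tailSquares ε) ≡ sumBy norm₁ (Cⱼ.squares ρ ++ Cⱼ.tailSquares ε)
  certificate-sameNorms ρ ε = sumBy-norm₁-cong (Pointwise.++⁺ (squares-sameCoeffs ρ) (refl ∷ refl ∷ []))

-- SoS proofs using a single equation of the system

module _ {n : ℕ} {D : Poly n} where

  singleMultiplier : {𝒫 : List (Poly n)} → Any (λ p → p ≈P D) 𝒫 → Poly n → Vec (Poly n) (length 𝒫)
  singleMultiplier {p ∷ 𝒫} (here _)    h = h ∷ Vec.replicate (length 𝒫) zeroP
  singleMultiplier {p ∷ 𝒫} (there D∈𝒫) h = zeroP ∷ singleMultiplier D∈𝒫 h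

  combo-zeroP : ∀ (𝒫 : List (Poly n)) → combo 𝒫 (Vec.replicate (length 𝒫) zeroP) ≡ zeroP
  combo-zeroP []      = refl
  combo-zeroP (p ∷ 𝒫) = combo-zeroP 𝒫

  combo-singleMultiplier : {𝒫 : List (Poly n)} (D∈𝒫 : Any (λ p → p ≈P D) 𝒫) (h : Poly n) →
                           combo 𝒫 (singleMultiplier D∈𝒫 h) ≋ h ⊗ D
  combo-singleMultiplier {p ∷ 𝒫} (here p≈D)  h rewrite combo-zeroP 𝒫 =
    ≋-trans (⊕-identityʳ (h ⊗ p)) (⊗-congˡ h (coeffwise p≈D))
  combo-singleMultiplier {p ∷ 𝒫} (there D∈𝒫) h = combo-singleMultiplier D∈𝒫 h

  allPairs-singleMultiplier : ∀ (R : Poly n → Poly n → Set) {𝒫 : List (Poly n)} (D∈𝒫 : Any (λ p → p ≈P D) 𝒫)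
    {h} → (∀ p → R p zeroP) → (∀ {p} → p ≈P D → R p h) → AllPairs R 𝒫 (singleMultiplier D∈𝒫 h)
  allPairs-singleMultiplier R {p ∷ 𝒫} (here p≈D) R-zero R-h = R-h p≈D , allPairs-zeroP 𝒫
    where
    allPairs-zeroP : ∀ 𝒫 → AllPairs R 𝒫 (Vec.replicate (length 𝒫) zeroP)
    allPairs-zeroP []      = tt
    allPairs-zeroP (p ∷ 𝒫) = R-zero p , allPairs-zeroP 𝒫
  allPairs-singleMultiplier R {p ∷ 𝒫} (there D∈𝒫) R-zero R-h =
    R-zero p , allPairs-singleMultiplier R D∈𝒫 R-zero R-h

  sosProof-singleMultiplier : ∀ {𝒫 : List (Poly n)} {q} S h {t B} →
    Any (λ p → p ≈P D) 𝒫 → 0ℚ ≤ B →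
    q ≋ sumSq S ⊕ h ⊗ D →
    All (λ s → DegLE (s ⊗ s) t) S → DegLE (h ⊗ D) t →
    All (λ s → CoeffLE s B) S → CoeffLE h B →
    SoSProof 𝒫 q t B
  sosProof-singleMultiplier S h {t} {B} D∈𝒫 B≥0 q≋ S-deg hD-deg S-coeff h-coeff = record
    { squares      = S
    ; multipliers  = singleMultiplier D∈𝒫 h
    ; identity     = coeff-≡ (≋-trans q≋ (⊕-congˡ (sumSq S) (≋-sym (combo-singleMultiplier D∈𝒫 h))))
    ; degSquares   = S-deg
    ; degMults     = allPairs-singleMultiplier (λ p h → DegLE (h ⊗ p) t) D∈𝒫
                       (λ _ _ c≢0 → ⊥-elim (c≢0 refl))
                       (λ p≈D → DegLE-resp-≋ (⊗-congˡ h (≋-sym (coeffwise p≈D))) hD-deg)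
    ; coeffSquares = S-coeff
    ; coeffMults   = allPairs-singleMultiplier (λ _ h → CoeffLE h B) D∈𝒫 (λ _ _ → B≥0) (λ _ → h-coeff)
    }

module _ {m : ℕ} (ρ : Vec ℚ m) where
  private
    module C₁ = Certificate {1} Fin.zero

  boxBound : ℚ
  boxBound = squareBound ρ ℚ.+ ℚ.½

  boxBound-pos : 0ℚ < boxBound
  boxBound-pos = ℚ.+-mono-≤-< (squareBound-nonNeg ρ) (ℚ.positive⁻¹ ℚ.½)

  -- Computed in one variable: the certificate for xᵢ among n variables has the same
  -- coefficient lists (certificate-sameNorms, multiplier-sameCoeffs).
  squaresNorm : ℚ → ℚ
  squaresNorm ε = sumBy norm₁ (C₁.squares ρ ++ C₁.tailSquares ε)

  multiplierNorm : ℚ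
  multiplierNorm = norm₁ (C₁.multiplier ρ)

  coefficientBound : ℚ
  coefficientBound = (squaresNorm ℚ.-½ ⊔ squaresNorm ℚ.½) ⊔ multiplierNorm

  boxBound-sosProofs : ∀ {n} {𝒫 : List (Poly n)} (i : Fin n) → Any (λ p → p ≈P domainPoly ρ i) 𝒫 →
    ∀ {t B} → suc m ℕ.+ suc m ℕ.≤ t → coefficientBound ≤ B →
    SoSProof 𝒫 (constP boxBound ⊕ negP (varP i)) t B × SoSProof 𝒫 (constP boxBound ⊕ varP i) t B
  boxBound-sosProofs {𝒫 = 𝒫} i D∈𝒫 {t} {B} 2m+2≤t bound≤B =
    sosProof ℚ.-½ (C.upperBound-identity (squareBound ρ))
                  (ℚ.p⊔q≤r⇒p≤r (squaresNorm ℚ.-½) (squaresNorm ℚ.½) squaresNorms≤B) ,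
    sosProof ℚ.½  (C.lowerBound-identity (squareBound ρ))
                  (ℚ.p⊔q≤r⇒q≤r (squaresNorm ℚ.-½) (squaresNorm ℚ.½) squaresNorms≤B)
    where
    module C = Certificate i

    squaresNorms≤B : squaresNorm ℚ.-½ ⊔ squaresNorm ℚ.½ ≤ B
    squaresNorms≤B = ℚ.p⊔q≤r⇒p≤r (squaresNorm ℚ.-½ ⊔ squaresNorm ℚ.½) multiplierNorm bound≤B

    multiplierNorm≤B : norm₁ (C.multiplier ρ) ≤ B
    multiplierNorm≤B = subst (_≤ B) (cong (sumBy ℚ.∣_∣) (sym (multiplier-sameCoeffs i Fin.zero ρ)))
                             (ℚ.p⊔q≤r⇒q≤r (squaresNorm ℚ.-½ ⊔ squaresNorm ℚ.½) multiplierNorm bound≤B)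

    B≥0 : 0ℚ ≤ B
    B≥0 = ℚ.≤-trans (norm₁-nonNeg (C.multiplier ρ)) multiplierNorm≤B

    multiplier-deg : DegLE (C.multiplier ρ ⊗ domainPoly ρ i) t
    multiplier-deg = termsDegLE⇒DegLE
      (termsDegLE-mono (ℕ.≤-trans (ℕ.≤-reflexive (cong suc (sym (ℕ.+-suc m m)))) 2m+2≤t)
                       (termsDegLE-⊗ (C.multiplier-deg ρ) (C.domainPoly-deg ρ)))

    sosProof : ∀ ε {q} → q ≋ (constP (squareBound ρ) ⊕ negP (C.x ⊗ C.x)) ⊕ sumSq (C.tailSquares ε) →
               squaresNorm ε ≤ B → SoSProof 𝒫 q t B
    sosProof ε q≋ squaresNorm≤B =
      sosProof-singleMultiplier {D = domainPoly ρ i} (C.squares ρ ++ C.tailSquares ε) (C.multiplier ρ) D∈𝒫 B≥0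
        (C.squareBound-certificate-++ ρ (C.tailSquares ε) q≋)
        (All.map (λ s-deg → termsDegLE⇒DegLE (termsDegLE-mono 2m+2≤t (termsDegLE-⊗ s-deg s-deg)))
                 (All.++⁺ (C.squares-deg ρ) (C.tailSquares-deg ε)))
        multiplier-deg
        (all-CoeffLE (C.squares ρ ++ C.tailSquares ε)
                     (subst (_≤ B) (sym (certificate-sameNorms i Fin.zero ρ ε)) squaresNorm≤B))
        (λ m → ℚ.≤-trans (∣coeff∣≤norm₁ (C.multiplier ρ) m) multiplierNorm≤B)

ℕ→ℚ≡mkℚ : ∀ k → ℕ→ℚ k ≡ ℚ.mkℚ (+ k) 0 (Coprime.sym (Coprime.1-coprimeTo k))
ℕ→ℚ≡mkℚ k = ℚ.normalize-coprime (Coprime.sym (Coprime.1-coprimeTo k))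

ℕ→ℚ-mono-≤ : ∀ {a b} → a ℕ.≤ b → ℕ→ℚ a ≤ ℕ→ℚ b
ℕ→ℚ-mono-≤ {a} {b} a≤b rewrite ℕ→ℚ≡mkℚ a | ℕ→ℚ≡mkℚ b =
  ℚ.*≤* (subst₂ ℤ._≤_ (sym (ℤ.*-identityʳ (+ a))) (sym (ℤ.*-identityʳ (+ b))) (ℤ.+≤+ a≤b))

archimedean : ∀ q → ∃ λ a → q ≤ ℕ→ℚ a
archimedean q@(ℚ.mkℚ (+ a) _ _)    =
  a , subst (q ≤_) (sym (ℕ→ℚ≡mkℚ a)) (ℚ.*≤* (ℤ.*-monoˡ-≤-nonNeg (+ a) (ℤ.+≤+ (ℕ.s≤s ℕ.z≤n))))
archimedean (ℚ.mkℚ ℤ.-[1+ _ ] _ _) = 0 , ℚ.*≤* ℤ.-≤+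

n≤2^n : ∀ n → n ℕ.≤ 2 ^ n
n≤2^n zero    = ℕ.z≤n
n≤2^n (suc n) = ℕ.≤-trans (ℕ.+-mono-≤ (ℕ.m^n>0 2 n) (n≤2^n n))
                          (ℕ.≤-reflexive (cong (2 ^ n ℕ.+_) (sym (ℕ.+-identityʳ (2 ^ n)))))

mainTheorem9 : (k : ℕ) (ρ : Vec ℚ (2 * k)) →
    ∃ λ (c : ℕ) → (d : ℕ) → ∃ λ (a : ℕ) →
      (n : ℕ) (𝒫 : List (Poly n)) → IsSystemOver ρ 𝒫 → (i : Fin n) →
        Σ ℚ λ N →
          (0ℚ < N) × (N ≤ ℕ→ℚ (2 ^ (a * (n ^ d) ^ a + a))) ×
          SoSProof 𝒫 (constP N ⊕ negP (varP i)) (c * d + c) (ℕ→ℚ (2 ^ (a * (n ^ d) ^ a + a))) ×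
          SoSProof 𝒫 (constP N ⊕ varP i) (c * d + c) (ℕ→ℚ (2 ^ (a * (n ^ d) ^ a + a)))
mainTheorem9 k ρ = c , λ d → a , λ n 𝒫 system i →
  let bound≤2^ = bound≤2^[e+a] (a * (n ^ d) ^ a) in
  boxBound ρ , boxBound-pos ρ , ℚ.p⊔q≤r⇒q≤r (coefficientBound ρ) (boxBound ρ) bound≤2^ ,
  boxBound-sosProofs ρ i (system i) (ℕ.m≤n+m c (c * d)) (ℚ.p⊔q≤r⇒p≤r (coefficientBound ρ) (boxBound ρ) bound≤2^)
  where
  c = suc (2 * k) + suc (2 * k)
  bound = coefficientBound ρ ⊔ boxBound ρ
  a = proj₁ (archimedean bound)

  bound≤2^[e+a] : ∀ e → bound ≤ ℕ→ℚ (2 ^ (e + a))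
  bound≤2^[e+a] e = ℚ.≤-trans (proj₂ (archimedean bound))
                              (ℕ→ℚ-mono-≤ (ℕ.≤-trans (n≤2^n a) (ℕ.^-monoʳ-≤ 2 (ℕ.m≤n+m a e))))
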